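{- Let $n\ge 3$, and let $k\ne 1$ and $\ell\ne 1$ be positive divisors of $n-1$. For integers $i,j$ and $N\ge 1$ let $m_N(i\backslash k; j\backslash \ell)$ denote the number of permutations $\sigma\in S_N$ with $\operatorname{maj}(\sigma)\equiv i\pmod k$ and $\operatorname{maj}(\sigma^{ -1})\equiv j\pmod \ell$. Then for all integers $i,j$, $$m_n(i\backslash k; j\backslash \ell)=(n-2)!\,\frac{(n-1)^2}{k\cdot\ell}+m_{n-1}(i\backslash k; j\backslash \ell).$$
   Context: $S_N$ is the symmetric group on $\{1,\ldots,N\}$. For $\sigma\in S_N$ and $1\le t\le N-1$, $t$ is a descent of $\sigma$ if $\sigma(t)>\sigma(t+1)$; the major index $\operatorname{maj}(\sigma)$ is the sum of the descents of $\sigma$. $\sigma^{ -1}$ is the inverse permutation. -}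

module Defs where

open import Data.Nat using (ℕ; zero; suc; _+_; _<ᵇ_)
import Data.Nat.Divisibility as ℕD
open import Data.Bool using (if_then_else_)
open import Data.Integer using (ℤ; +_; _-_)
open import Data.Integer.Divisibility using (_∣_)
open import Data.Fin using (Fin; toℕ)
open import Data.Fin.Properties using (all?)
open import Data.Vec using (Vec; []; _∷_; lookup; toList)
open import Data.List using (List; []; _∷_; map; concatMap; length; filter; allFin)
open import Data.Product using (_×_; _,_; proj₁; proj₂)
open import Relation.Binary.PropositionalEquality using (_≡_)
open import Relation.Nullary using (Dec)
open import Relation.Nullary.Decidable using (_×-dec_)
import Data.Fin.Properties as FinP
import Data.Integer as ℤ

allVec : (N m : ℕ) → List (Vec (Fin N) m)
allVec N zero    = [] ∷ []
allVec N (suc m) = concatMap (λ x → map (x ∷_) (allVec N m)) (allFin N)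

-- A permutation of {1..N} is represented (0-indexed) by the vector of its values
-- σ = (σ(1), …, σ(N)).  Application:
app : ∀ {N} → Vec (Fin N) N → Fin N → Fin N
app σ x = lookup σ x

IsInverse : ∀ {N} → Vec (Fin N) N → Vec (Fin N) N → Set
IsInverse {N} σ τ = (∀ x → app τ (app σ x) ≡ x) × (∀ x → app σ (app τ x) ≡ x)

isInverse? : ∀ {N} (σ τ : Vec (Fin N) N) → Dec (IsInverse σ τ)
isInverse? σ τ = all? (λ x → app τ (app σ x) FinP.≟ x) ×-dec all? (λ x → app σ (app τ x) FinP.≟ x)

-- Major index of a sequence a_1 a_2 … : sum of positions t with a_t > a_{t+1}.
-- majAux t l : l's head sits at (1-based) position t.
majAux : ℕ → List ℕ → ℕ
majAux t (a ∷ b ∷ rest) = (if b <ᵇ a then t else 0) + majAux (suc t) (b ∷ rest)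
majAux t _              = 0

maj : ∀ {N} → Vec (Fin N) N → ℕ
maj σ = majAux 1 (map toℕ (toList σ))

_≡_[mod_] : ℕ → ℤ → ℕ → Set
a ≡ i [mod k ] = (+ k) ∣ ((+ a) - i)

_≡?_[mod_] : (a : ℕ) (i : ℤ) (k : ℕ) → Dec (a ≡ i [mod k ])
a ≡? i [mod k ] = k ℕD.∣? ℤ.∣ (+ a) - i ∣

-- Pairs (σ, σ⁻¹) with σ ∈ S_N; each σ ∈ S_N occurs exactly once (inverses are unique).
permPairs : (N : ℕ) → List (Vec (Fin N) N × Vec (Fin N) N)
permPairs N = filter (λ p → isInverse? (proj₁ p) (proj₂ p))
                (concatMap (λ σ → map (σ ,_) (allVec N N)) (allVec N N))

mCount : (N : ℕ) (i : ℤ) (k : ℕ) (j : ℤ) (ℓ : ℕ) → ℕ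
mCount N i k j ℓ =
  length (filter (λ p → (maj (proj₁ p) ≡? i [mod k ]) ×-dec (maj (proj₂ p) ≡? j [mod ℓ ]))
                 (permPairs N))

-- Write n = N + 1. Every permutation of [N+1] arises exactly once from some σ ∈ S_N by inserting
-- the new maximum at a position p, and its inverse is then σ⁻¹ (values ≥ p shifted up) followed
-- by p. Appending p changes maj σ⁻¹ by 0 or N, which is invisible modulo ℓ ∣ N, while by
-- MacMahon's insertion lemma the major index of the new permutation runs through maj σ + r,
-- 0 ≤ r ≤ N, once each. Besides r = 0 these are N consecutive integers, of which N/k lie in the
-- class of i modulo k ∣ N; hence m_{N+1} = m_N + (N/k)·#{σ ∈ S_N : maj σ⁻¹ ≡ j mod ℓ}, and the
-- same argument applied to σ⁻¹ shows that the last count is (N/ℓ)·(N−1)!.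

module Submission where

open import Defs
import Algebra.Properties.CommutativeSemigroup as CommSemigroupProperties
open import Data.Bool using (Bool; true; false; if_then_else_)
open import Data.Fin using (Fin; zero; suc; toℕ; fromℕ; punchIn; punchOut)
open import Data.Fin.Properties
  using (toℕ-fromℕ; toℕ<n; punchInᵢ≢i; punchIn-injective; punchIn-punchOut; _≟_)
open import Data.Integer using (ℤ)
import Data.Integer as Int
open import Data.Integer.DivMod using (_%ℕ_; _/ℕ_; a≡a%ℕn+[a/ℕn]*n)
open import Data.Integer.Divisibility.Signed
  using (∣ᵤ⇒∣; ∣⇒∣ᵤ; ∣m∣n⇒∣m+n; ∣m+n∣m⇒∣n; ∣m+n∣n⇒∣m; ∣m⇒∣-m; ∣n⇒∣m*n)
  renaming (_∣_ to _∣ℤ_; ∣-refl to ∣ℤ-refl)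
open import Data.Integer.Properties using (pos-+)
import Data.Integer.Tactic.RingSolver as ℤ-Solver
open import Data.List as List using (List; []; _∷_; _∷ʳ_; _++_; length; filter; concatMap; allFin)
open import Data.List.Properties using (length-++; map-tabulate; map-cong; map-∘)
open import Data.List.Relation.Unary.All using (All; []; _∷_)
open import Data.List.Relation.Unary.All.Properties using (∷ʳ⁻)
open import Data.List.Reverse using (Reverse; reverseView; []; _∶_∶ʳ_)
open import Data.Nat
  using (ℕ; zero; suc; _+_; _*_; _∸_; _^_; _≤_; _<_; _<ᵇ_; _!; _/_; NonZero; z≤n; s≤s; s≤s⁻¹)
open import Data.Nat.Divisibility using (_∣_; divides; ∣-refl; ∣⇒≤; *-pres-∣)
open import Data.Nat.DivMod using (m*n/n≡m; *-/-assoc; /-*-interchange)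
open import Data.Nat.Properties
  using (+-commutativeSemigroup; *-commutativeSemigroup; +-assoc; +-comm; +-identityʳ; +-suc;
         +-cancelʳ-≡; *-zeroʳ; *-identityʳ; *-distribˡ-+; *-distribʳ-+; m<n⇒m<1+n; ≤-refl; <⇒≤; <⇒≱;
         m*n≢0)
open import Data.Nat.Tactic.RingSolver using (solve-∀)
open import Data.Product using (_×_; _,_; proj₁; proj₂)
import Data.Product as Product
open import Data.Vec using (Vec; []; _∷_; lookup; insertAt; map; toList)
open import Data.Vec.Properties using (insertAt-lookup; insertAt-punchIn; lookup-map; toList-map)
open import Function using (_∘_; _∘′_; id; _⇔_; mk⇔)
open import Relation.Binary.PropositionalEquality
open import Relation.Nullary using (Dec; does; yes; no; ¬_)
open import Relation.Nullary.Decidable using (_×-dec_; does-⇔; dec-true; dec-false)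
open import Relation.Unary using (Decidable)

open CommSemigroupProperties +-commutativeSemigroup using ()
  renaming (interchange to +-interchange; x∙yz≈y∙xz to +-leftComm)
open CommSemigroupProperties *-commutativeSemigroup using ()
  renaming (x∙yz≈y∙xz to *-leftComm; x∙yz≈y∙zx to *-rotate)

-- Finite sums

∑ : {A : Set} → List A → (A → ℕ) → ℕ
∑ []       f = 0
∑ (x ∷ xs) f = f x + ∑ xs f

syntax ∑ xs (λ x → e) = ∑[ x ∈ xs ] e

private variable A B : Set

∑-cong : ∀ (xs : List A) {f g : A → ℕ} → (∀ x → f x ≡ g x) → ∑ xs f ≡ ∑ xs g
∑-cong []       f≗g = refl
∑-cong (x ∷ xs) f≗g = cong₂ _+_ (f≗g x) (∑-cong xs f≗g)

∑-zero : ∀ (xs : List A) {f : A → ℕ} → (∀ x → f x ≡ 0) → ∑ xs f ≡ 0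
∑-zero []       f≗0 = refl
∑-zero (x ∷ xs) f≗0 = cong₂ _+_ (f≗0 x) (∑-zero xs f≗0)

∑-++ : ∀ (xs ys : List A) (f : A → ℕ) → ∑ (xs ++ ys) f ≡ ∑ xs f + ∑ ys f
∑-++ []       ys f = refl
∑-++ (x ∷ xs) ys f = trans (cong (f x +_) (∑-++ xs ys f)) (sym (+-assoc (f x) _ _))

∑-+ : ∀ (xs : List A) (f g : A → ℕ) → ∑[ x ∈ xs ] (f x + g x) ≡ ∑ xs f + ∑ xs g
∑-+ []       f g = refl
∑-+ (x ∷ xs) f g = trans (cong (f x + g x +_) (∑-+ xs f g)) (+-interchange (f x) (g x) _ _)

∑-*ˡ : ∀ (xs : List A) c (f : A → ℕ) → ∑[ x ∈ xs ] (c * f x) ≡ c * ∑ xs f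
∑-*ˡ []       c f = sym (*-zeroʳ c)
∑-*ˡ (x ∷ xs) c f = trans (cong (c * f x +_) (∑-*ˡ xs c f)) (sym (*-distribˡ-+ c (f x) _))

∑-*ʳ : ∀ (xs : List A) c (f : A → ℕ) → ∑[ x ∈ xs ] (f x * c) ≡ ∑ xs f * c
∑-*ʳ []       c f = refl
∑-*ʳ (x ∷ xs) c f = trans (cong (f x * c +_) (∑-*ʳ xs c f)) (sym (*-distribʳ-+ c (f x) _))

∑-map : ∀ (h : B → A) (ys : List B) (f : A → ℕ) → ∑ (List.map h ys) f ≡ ∑[ y ∈ ys ] f (h y)
∑-map h []       f = refl
∑-map h (y ∷ ys) f = cong (f (h y) +_) (∑-map h ys f)

∑-concatMap : ∀ (h : B → List A) (ys : List B) (f : A → ℕ) →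
              ∑ (concatMap h ys) f ≡ ∑[ y ∈ ys ] ∑ (h y) f
∑-concatMap h []       f = refl
∑-concatMap h (y ∷ ys) f = trans (∑-++ (h y) _ f) (cong (∑ (h y) f +_) (∑-concatMap h ys f))

∑-comm : ∀ (xs : List A) (ys : List B) (f : A → B → ℕ) →
         ∑[ x ∈ xs ] ∑[ y ∈ ys ] f x y ≡ ∑[ y ∈ ys ] ∑[ x ∈ xs ] f x y
∑-comm []       ys f = sym (∑-zero ys (λ _ → refl))
∑-comm (x ∷ xs) ys f = trans (cong (∑ ys (f x) +_) (∑-comm xs ys f)) (sym (∑-+ ys (f x) _))

𝟙 : ∀ {p} {P : Set p} → Dec P → ℕ
𝟙 P? = if does P? then 1 else 0

module _ {p q} {P : Set p} {Q : Set q} where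

  𝟙-⇔ : P ⇔ Q → (P? : Dec P) (Q? : Dec Q) → 𝟙 P? ≡ 𝟙 Q?
  𝟙-⇔ P⇔Q P? Q? = cong (if_then 1 else 0) (does-⇔ P⇔Q P? Q?)

  𝟙-×-dec : (P? : Dec P) (Q? : Dec Q) → 𝟙 (P? ×-dec Q?) ≡ 𝟙 P? * 𝟙 Q?
  𝟙-×-dec (yes _) Q? = sym (+-identityʳ (𝟙 Q?))
  𝟙-×-dec (no _)  Q? = refl

𝟙-yes : ∀ {p} {P : Set p} (P? : Dec P) → P → 𝟙 P? ≡ 1
𝟙-yes P? p = cong (if_then 1 else 0) (dec-true P? p)

𝟙-no : ∀ {p} {P : Set p} (P? : Dec P) → ¬ P → 𝟙 P? ≡ 0
𝟙-no P? ¬p = cong (if_then 1 else 0) (dec-false P? ¬p)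

module _ {P : A → Set} (P? : Decidable P) where

  length-filter : ∀ xs → length (filter P? xs) ≡ ∑[ x ∈ xs ] 𝟙 (P? x)
  length-filter []       = refl
  length-filter (x ∷ xs) with does (P? x)
  ... | true  = cong suc (length-filter xs)
  ... | false = length-filter xs

  ∑-filter : ∀ xs f → ∑ (filter P? xs) f ≡ ∑[ x ∈ xs ] (𝟙 (P? x) * f x)
  ∑-filter []       f = refl
  ∑-filter (x ∷ xs) f with does (P? x)
  ... | true  = cong₂ _+_ (sym (+-identityʳ (f x))) (∑-filter xs f)
  ... | false = ∑-filter xs f

∑< : ℕ → (ℕ → ℕ) → ℕ
∑< zero    f = 0
∑< (suc n) f = ∑< n f + f n

syntax ∑< n (λ r → e) = ∑[ r < n ] e

∑<-cong : ∀ n {f g : ℕ → ℕ} → (∀ r → r < n → f r ≡ g r) → ∑< n f ≡ ∑< n g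
∑<-cong zero    f≗g = refl
∑<-cong (suc n) f≗g = cong₂ _+_ (∑<-cong n (λ r r<n → f≗g r (m<n⇒m<1+n r<n))) (f≗g n ≤-refl)

∑<-zero : ∀ n {f : ℕ → ℕ} → (∀ r → r < n → f r ≡ 0) → ∑< n f ≡ 0
∑<-zero zero    f≗0 = refl
∑<-zero (suc n) f≗0 = cong₂ _+_ (∑<-zero n (λ r r<n → f≗0 r (m<n⇒m<1+n r<n))) (f≗0 n ≤-refl)

∑<-suc : ∀ n (f : ℕ → ℕ) → ∑[ r < suc n ] f r ≡ f 0 + ∑[ r < n ] f (suc r)
∑<-suc zero    f = +-comm 0 (f 0)
∑<-suc (suc n) f = trans (cong (_+ f (suc n)) (∑<-suc n f)) (+-assoc (f 0) _ _)

∑<-rotate : ∀ n (f : ℕ → ℕ) → ∑[ r < n ] f (suc r) + f 0 ≡ ∑[ r < suc n ] f r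
∑<-rotate n f = trans (+-comm _ (f 0)) (sym (∑<-suc n f))

∑<-+ : ∀ m n (f : ℕ → ℕ) → ∑[ r < m + n ] f r ≡ ∑[ r < m ] f r + ∑[ r < n ] f (m + r)
∑<-+ m zero    f = trans (cong (λ l → ∑< l f) (+-identityʳ m)) (sym (+-identityʳ _))
∑<-+ m (suc n) f = begin
    ∑< (m + suc n) f             ≡⟨ cong (λ l → ∑< l f) (+-suc m n) ⟩
    ∑< (m + n) f + f (m + n)     ≡⟨ cong (_+ f (m + n)) (∑<-+ m n f) ⟩
    ∑< m f + ∑[ r < n ] f (m + r) + f (m + n)  ≡⟨ +-assoc (∑< m f) _ _ ⟩
    ∑< m f + ∑[ r < suc n ] f (m + r) ∎
  where open ≡-Reasoning

∑<-const : ∀ n c → ∑[ r < n ] c ≡ n * c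
∑<-const zero    c = refl
∑<-const (suc n) c = trans (cong (_+ c) (∑<-const n c)) (+-comm (n * c) c)

∑-allFin-suc : ∀ n (F : Fin (suc n) → ℕ) → ∑ (allFin (suc n)) F ≡ F zero + ∑[ j ∈ allFin n ] F (suc j)
∑-allFin-suc n F =
  cong (F zero +_) (trans (cong (λ js → ∑ js F) (sym (map-tabulate id suc))) (∑-map suc (allFin n) F))

∑-allFin-punchIn : ∀ n (p : Fin (suc n)) F →
                   ∑ (allFin (suc n)) F ≡ F p + ∑[ j ∈ allFin n ] F (punchIn p j)
∑-allFin-punchIn n       zero    F = ∑-allFin-suc n F
∑-allFin-punchIn (suc n) (suc p) F = begin
    ∑ (allFin (suc (suc n))) F
  ≡⟨ ∑-allFin-suc (suc n) F ⟩
    F zero + ∑[ j ∈ allFin (suc n) ] F (suc j)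
  ≡⟨ cong (F zero +_) (∑-allFin-punchIn n p (F ∘ suc)) ⟩
    F zero + (F (suc p) + ∑[ j ∈ allFin n ] F (suc (punchIn p j)))
  ≡⟨ +-leftComm (F zero) (F (suc p)) _ ⟩
    F (suc p) + (F zero + ∑[ j ∈ allFin n ] F (suc (punchIn p j)))
  ≡⟨ cong (F (suc p) +_) (sym (∑-allFin-suc n (F ∘ punchIn (suc p)))) ⟩
    F (suc p) + ∑[ j ∈ allFin (suc n) ] F (punchIn (suc p) j) ∎
  where open ≡-Reasoning

∑-allFin-toℕ : ∀ n (f : ℕ → ℕ) → ∑[ j ∈ allFin n ] f (toℕ j) ≡ ∑[ r < n ] f r
∑-allFin-toℕ zero    f = refl
∑-allFin-toℕ (suc n) f = begin
    ∑[ j ∈ allFin (suc n) ] f (toℕ j)      ≡⟨ ∑-allFin-suc n (λ j → f (toℕ j)) ⟩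
    f 0 + ∑[ j ∈ allFin n ] f (suc (toℕ j)) ≡⟨ cong (f 0 +_) (∑-allFin-toℕ n (λ r → f (suc r))) ⟩
    f 0 + ∑[ r < n ] f (suc r)             ≡⟨ sym (∑<-suc n f) ⟩
    ∑[ r < suc n ] f r ∎
  where open ≡-Reasoning

-- Sums over vectors and permutations

∑-allVec-suc : ∀ N m (F : Vec (Fin N) (suc m) → ℕ) →
               ∑ (allVec N (suc m)) F ≡ ∑[ x ∈ allFin N ] ∑[ w ∈ allVec N m ] F (x ∷ w)
∑-allVec-suc N m F =
  trans (∑-concatMap _ (allFin N) F) (∑-cong (allFin N) (λ x → ∑-map (x ∷_) (allVec N m) F))

∑-allVec-insertAt : ∀ N m (p : Fin (suc m)) (F : Vec (Fin N) (suc m) → ℕ) →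
                    ∑ (allVec N (suc m)) F ≡ ∑[ w ∈ allVec N m ] ∑[ x ∈ allFin N ] F (insertAt w p x)
∑-allVec-insertAt N m       zero    F =
  trans (∑-allVec-suc N m F) (∑-comm (allFin N) (allVec N m) (λ x w → F (x ∷ w)))
∑-allVec-insertAt N (suc m) (suc p) F = begin
    ∑ (allVec N (suc (suc m))) F
  ≡⟨ ∑-allVec-suc N (suc m) F ⟩
    ∑[ y ∈ allFin N ] ∑[ v ∈ allVec N (suc m) ] F (y ∷ v)
  ≡⟨ ∑-cong (allFin N) (λ y → ∑-allVec-insertAt N m p (λ v → F (y ∷ v))) ⟩
    ∑[ y ∈ allFin N ] ∑[ w ∈ allVec N m ] ∑[ x ∈ allFin N ] F (y ∷ insertAt w p x)
  ≡⟨ sym (∑-allVec-suc N m (λ w → ∑[ x ∈ allFin N ] F (insertAt w (suc p) x))) ⟩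
    ∑[ w ∈ allVec N (suc m) ] ∑[ x ∈ allFin N ] F (insertAt w (suc p) x) ∎
  where open ≡-Reasoning

∑-allVec-punchIn : ∀ N m (p : Fin (suc N)) (F : Vec (Fin (suc N)) m → ℕ) →
                   (∀ v y → lookup v y ≡ p → F v ≡ 0) →
                   ∑ (allVec (suc N) m) F ≡ ∑[ u ∈ allVec N m ] F (map (punchIn p) u)
∑-allVec-punchIn N zero    p F F-avoids = refl
∑-allVec-punchIn N (suc m) p F F-avoids = begin
    ∑ (allVec (suc N) (suc m)) F
  ≡⟨ ∑-allVec-suc (suc N) m F ⟩
    ∑[ x ∈ allFin (suc N) ] ∑[ v ∈ allVec (suc N) m ] F (x ∷ v)
  ≡⟨ ∑-cong (allFin (suc N)) (λ x → ∑-allVec-punchIn N m p (λ v → F (x ∷ v))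
                                      (λ v y → F-avoids (x ∷ v) (suc y))) ⟩
    ∑[ x ∈ allFin (suc N) ] ∑[ u ∈ allVec N m ] F (x ∷ map (punchIn p) u)
  ≡⟨ ∑-allFin-punchIn N p _ ⟩
    ∑[ u ∈ allVec N m ] F (p ∷ map (punchIn p) u) + rest
  ≡⟨ cong (_+ rest) (∑-zero (allVec N m) (λ u → F-avoids (p ∷ map (punchIn p) u) zero refl)) ⟩
    rest
  ≡⟨ sym (∑-allVec-suc N m (λ u → F (map (punchIn p) u))) ⟩
    ∑[ u ∈ allVec N (suc m) ] F (map (punchIn p) u) ∎
  where
  open ≡-Reasoning
  rest = ∑[ y ∈ allFin N ] ∑[ u ∈ allVec N m ] F (punchIn p y ∷ map (punchIn p) u)

data PunchInView {n} (q : Fin (suc n)) : Fin (suc n) → Set where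
  at      : PunchInView q q
  punched : ∀ z → PunchInView q (punchIn q z)

punchInView : ∀ {n} (q a : Fin (suc n)) → PunchInView q a
punchInView q a with a ≟ q
... | yes refl = at
... | no a≢q   = subst (PunchInView q) (punchIn-punchOut (a≢q ∘ sym)) (punched (punchOut (a≢q ∘ sym)))

module _ {N : ℕ} where

  insertAt-inverse-fresh : ∀ (v : Vec (Fin (suc N)) N) p x τ y →
                           IsInverse (insertAt v p x) τ → lookup v y ≢ x
  insertAt-inverse-fresh v p x τ y (τσ≗id , _) vy≡x = punchInᵢ≢i p y (begin
      punchIn p y                  ≡⟨ sym (τσ≗id (punchIn p y)) ⟩
      app τ (app σ (punchIn p y))  ≡⟨ cong (app τ) (insertAt-punchIn v p x y) ⟩
      app τ (lookup v y)           ≡⟨ cong (app τ) (trans vy≡x (sym (insertAt-lookup v p x))) ⟩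
      app τ (app σ p)              ≡⟨ τσ≗id p ⟩
      p ∎)
    where
    open ≡-Reasoning
    σ = insertAt v p x

  insertAt-inverse-last : ∀ (w v : Vec (Fin (suc N)) N) p x →
                          IsInverse (insertAt w p x) (insertAt v (fromℕ N) p) → x ≡ fromℕ N
  insertAt-inverse-last w v p x (_ , στ≗id) = begin
      x                                    ≡⟨ sym (insertAt-lookup w p x) ⟩
      app σ p                              ≡⟨ cong (app σ) (sym (insertAt-lookup v (fromℕ N) p)) ⟩
      app σ (app τ (fromℕ N))              ≡⟨ στ≗id (fromℕ N) ⟩
      fromℕ N ∎
    where
    open ≡-Reasoning
    σ = insertAt w p x
    τ = insertAt v (fromℕ N) p

  insertMax : Vec (Fin N) N → Fin (suc N) → Vec (Fin (suc N)) (suc N)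
  insertMax σ p = insertAt (map (punchIn (fromℕ N)) σ) p (fromℕ N)

  appendValue : Vec (Fin N) N → Fin (suc N) → Vec (Fin (suc N)) (suc N)
  appendValue τ p = insertAt (map (punchIn p) τ) (fromℕ N) p

  IsInverse-insertMax : ∀ (σ τ : Vec (Fin N) N) p →
                        IsInverse (insertMax σ p) (appendValue τ p) ⇔ IsInverse σ τ
  IsInverse-insertMax σ τ p = mk⇔ to from
    where
    σ⁺ = insertMax σ p
    τ⁺ = appendValue τ p
    last = fromℕ N

    σ⁺-p : app σ⁺ p ≡ last
    σ⁺-p = insertAt-lookup _ p last
    σ⁺-punchIn : ∀ z → app σ⁺ (punchIn p z) ≡ punchIn last (app σ z)
    σ⁺-punchIn z = trans (insertAt-punchIn _ p last z) (lookup-map z (punchIn last) σ)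
    τ⁺-last : app τ⁺ last ≡ p
    τ⁺-last = insertAt-lookup _ last p
    τ⁺-punchIn : ∀ z → app τ⁺ (punchIn last z) ≡ punchIn p (app τ z)
    τ⁺-punchIn z = trans (insertAt-punchIn _ last p z) (lookup-map z (punchIn p) τ)

    to : IsInverse σ⁺ τ⁺ → IsInverse σ τ
    to (τσ≗id , στ≗id) =
      (λ z → punchIn-injective p _ _ (begin
         punchIn p (app τ (app σ z))          ≡⟨ sym (τ⁺-punchIn (app σ z)) ⟩
         app τ⁺ (punchIn last (app σ z))      ≡⟨ cong (app τ⁺) (sym (σ⁺-punchIn z)) ⟩
         app τ⁺ (app σ⁺ (punchIn p z))        ≡⟨ τσ≗id (punchIn p z) ⟩
         punchIn p z ∎)) ,
      (λ z → punchIn-injective last _ _ (begin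
         punchIn last (app σ (app τ z))       ≡⟨ sym (σ⁺-punchIn (app τ z)) ⟩
         app σ⁺ (punchIn p (app τ z))         ≡⟨ cong (app σ⁺) (sym (τ⁺-punchIn z)) ⟩
         app σ⁺ (app τ⁺ (punchIn last z))     ≡⟨ στ≗id (punchIn last z) ⟩
         punchIn last z ∎))
      where open ≡-Reasoning

    from : IsInverse σ τ → IsInverse σ⁺ τ⁺
    from (τσ≗id , στ≗id) = τ⁺σ⁺≗id , σ⁺τ⁺≗id
      where
      τ⁺σ⁺≗id : ∀ a → app τ⁺ (app σ⁺ a) ≡ a
      τ⁺σ⁺≗id a with punchInView p a
      ... | at       = trans (cong (app τ⁺) σ⁺-p) τ⁺-last
      ... | punched z = trans (cong (app τ⁺) (σ⁺-punchIn z))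
                          (trans (τ⁺-punchIn (app σ z)) (cong (punchIn p) (τσ≗id z)))
      σ⁺τ⁺≗id : ∀ a → app σ⁺ (app τ⁺ a) ≡ a
      σ⁺τ⁺≗id a with punchInView last a
      ... | at       = trans (cong (app σ⁺) τ⁺-last) σ⁺-p
      ... | punched z = trans (cong (app σ⁺) (τ⁺-punchIn z))
                          (trans (σ⁺-punchIn (app τ z)) (cong (punchIn last) (στ≗id z)))

  ∑-inverses-insertMax : ∀ (v : Vec (Fin (suc N)) N) p (G : Vec (Fin (suc N)) (suc N) → ℕ) →
    ∑[ σ ∈ allVec (suc N) (suc N) ] (𝟙 (isInverse? σ (insertAt v (fromℕ N) p)) * G σ)
      ≡ ∑[ σ ∈ allVec N N ] (𝟙 (isInverse? (insertMax σ p) (insertAt v (fromℕ N) p)) * G (insertMax σ p))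
  ∑-inverses-insertMax v p G = begin
      ∑ (allVec (suc N) (suc N)) W
    ≡⟨ ∑-allVec-insertAt (suc N) N p W ⟩
      ∑[ w ∈ allVec (suc N) N ] ∑[ x ∈ allFin (suc N) ] W (insertAt w p x)
    ≡⟨ ∑-cong (allVec (suc N) N) value-at-p-is-last ⟩
      ∑[ w ∈ allVec (suc N) N ] W (insertAt w p last)
    ≡⟨ ∑-allVec-punchIn N N last _ (λ w y wy≡last →
         W-zero (λ inv → insertAt-inverse-fresh w p last τ y inv wy≡last)) ⟩
      ∑[ σ ∈ allVec N N ] W (insertMax σ p) ∎
    where
    open ≡-Reasoning
    last = fromℕ N
    τ = insertAt v last p
    W : Vec (Fin (suc N)) (suc N) → ℕ
    W σ = 𝟙 (isInverse? σ τ) * G σ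
    W-zero : ∀ {σ} → ¬ IsInverse σ τ → W σ ≡ 0
    W-zero {σ} ¬inv = cong (_* G σ) (𝟙-no (isInverse? σ τ) ¬inv)
    value-at-p-is-last : ∀ w → ∑[ x ∈ allFin (suc N) ] W (insertAt w p x) ≡ W (insertAt w p last)
    value-at-p-is-last w = begin
        ∑[ x ∈ allFin (suc N) ] W (insertAt w p x)
      ≡⟨ ∑-allFin-punchIn N last _ ⟩
        W (insertAt w p last) + ∑[ j ∈ allFin N ] W (insertAt w p (punchIn last j))
      ≡⟨ cong (W (insertAt w p last) +_) (∑-zero (allFin N) (λ j →
           W-zero (punchInᵢ≢i last j ∘ insertAt-inverse-last w v p (punchIn last j)))) ⟩
        W (insertAt w p last) + 0
      ≡⟨ +-identityʳ _ ⟩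
        W (insertAt w p last) ∎

  ∑-inverses-appendValue : ∀ p (F : Vec (Fin (suc N)) (suc N) → Vec (Fin (suc N)) (suc N) → ℕ) →
    ∑[ v ∈ allVec (suc N) N ] ∑[ σ ∈ allVec N N ]
        (𝟙 (isInverse? (insertMax σ p) (insertAt v (fromℕ N) p)) * F (insertMax σ p) (insertAt v (fromℕ N) p))
      ≡ ∑[ τ ∈ allVec N N ] ∑[ σ ∈ allVec N N ] (𝟙 (isInverse? σ τ) * F (insertMax σ p) (appendValue τ p))
  ∑-inverses-appendValue p F = trans
    (∑-allVec-punchIn N N p _ (λ v y vy≡p → ∑-zero (allVec N N) (λ σ → W-zero v σ (λ inv →
       insertAt-inverse-fresh v (fromℕ N) p (insertMax σ p) y (Product.swap inv) vy≡p))))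
    (∑-cong (allVec N N) (λ τ → ∑-cong (allVec N N) (λ σ →
       cong (_* F (insertMax σ p) (appendValue τ p))
            (𝟙-⇔ (IsInverse-insertMax σ τ p)
                 (isInverse? (insertMax σ p) (appendValue τ p)) (isInverse? σ τ)))))
    where
    W-zero : ∀ v σ → let τ = insertAt v (fromℕ N) p in
             ¬ IsInverse (insertMax σ p) τ → 𝟙 (isInverse? (insertMax σ p) τ) * F (insertMax σ p) τ ≡ 0
    W-zero v σ ¬inv = cong (_* F (insertMax σ p) τ) (𝟙-no (isInverse? (insertMax σ p) τ) ¬inv)
      where τ = insertAt v (fromℕ N) p

∑Perm : (N : ℕ) → (Vec (Fin N) N → Vec (Fin N) N → ℕ) → ℕ
∑Perm N F = ∑[ σ ∈ allVec N N ] ∑[ τ ∈ allVec N N ] (𝟙 (isInverse? σ τ) * F σ τ)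

∑Perm-suc : ∀ N (F : Vec (Fin (suc N)) (suc N) → Vec (Fin (suc N)) (suc N) → ℕ) →
  ∑Perm (suc N) F ≡ ∑Perm N (λ σ τ → ∑[ p ∈ allFin (suc N) ] F (insertMax σ p) (appendValue τ p))
∑Perm-suc N F = begin
    ∑[ σ ∈ S⁺ ] ∑[ τ ∈ S⁺ ] W σ τ
  ≡⟨ ∑-comm S⁺ S⁺ W ⟩
    ∑[ τ ∈ S⁺ ] ∑[ σ ∈ S⁺ ] W σ τ
  ≡⟨ ∑-allVec-insertAt (suc N) N last _ ⟩
    ∑[ v ∈ V ] ∑[ p ∈ P ] ∑[ σ ∈ S⁺ ] W σ (insertAt v last p)
  ≡⟨ ∑-comm V P _ ⟩
    ∑[ p ∈ P ] ∑[ v ∈ V ] ∑[ σ ∈ S⁺ ] W σ (insertAt v last p)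
  ≡⟨ ∑-cong P (λ p → ∑-cong V (λ v → ∑-inverses-insertMax v p (λ σ → F σ (insertAt v last p)))) ⟩
    ∑[ p ∈ P ] ∑[ v ∈ V ] ∑[ σ ∈ S ] W (insertMax σ p) (insertAt v last p)
  ≡⟨ ∑-cong P (λ p → ∑-inverses-appendValue p F) ⟩
    ∑[ p ∈ P ] ∑[ τ ∈ S ] ∑[ σ ∈ S ] (𝟙 (isInverse? σ τ) * F⁻ σ τ p)
  ≡⟨ ∑-comm P S _ ⟩
    ∑[ τ ∈ S ] ∑[ p ∈ P ] ∑[ σ ∈ S ] (𝟙 (isInverse? σ τ) * F⁻ σ τ p)
  ≡⟨ ∑-cong S (λ τ → ∑-comm P S _) ⟩
    ∑[ τ ∈ S ] ∑[ σ ∈ S ] ∑[ p ∈ P ] (𝟙 (isInverse? σ τ) * F⁻ σ τ p)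
  ≡⟨ ∑-comm S S _ ⟩
    ∑[ σ ∈ S ] ∑[ τ ∈ S ] ∑[ p ∈ P ] (𝟙 (isInverse? σ τ) * F⁻ σ τ p)
  ≡⟨ ∑-cong S (λ σ → ∑-cong S (λ τ → ∑-*ˡ P (𝟙 (isInverse? σ τ)) (F⁻ σ τ))) ⟩
    ∑Perm N (λ σ τ → ∑[ p ∈ P ] F⁻ σ τ p) ∎
  where
  open ≡-Reasoning
  S⁺ = allVec (suc N) (suc N)
  V = allVec (suc N) N
  S = allVec N N
  P = allFin (suc N)
  last = fromℕ N
  W : Vec (Fin (suc N)) (suc N) → Vec (Fin (suc N)) (suc N) → ℕ
  W σ τ = 𝟙 (isInverse? σ τ) * F σ τ
  F⁻ : Vec (Fin N) N → Vec (Fin N) N → Fin (suc N) → ℕ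
  F⁻ σ τ p = F (insertMax σ p) (appendValue τ p)

-- The major index of words

<ᵇ-true : ∀ {m n} → m < n → (m <ᵇ n) ≡ true
<ᵇ-true {zero}  {suc n} _         = refl
<ᵇ-true {suc m} {suc n} (s≤s m<n) = <ᵇ-true m<n

<ᵇ-false : ∀ {m n} → n ≤ m → (m <ᵇ n) ≡ false
<ᵇ-false {m}     {zero}  _         = refl
<ᵇ-false {suc m} {suc n} (s≤s n≤m) = <ᵇ-false n≤m

lastOr : ℕ → List ℕ → ℕ
lastOr d []       = d
lastOr d (x ∷ xs) = lastOr x xs

lastOr-∷ʳ : ∀ d xs y → lastOr d (xs ∷ʳ y) ≡ y
lastOr-∷ʳ d []       y = refl
lastOr-∷ʳ d (x ∷ xs) y = lastOr-∷ʳ x xs y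

lastOr-≤ : ∀ {M} d xs → d ≤ M → All (_< M) xs → lastOr d xs ≤ M
lastOr-≤ d []       d≤M []          = d≤M
lastOr-≤ d (x ∷ xs) d≤M (x<M ∷ xs<M) = lastOr-≤ x xs (<⇒≤ x<M) xs<M

length-∷ʳ : ∀ (xs : List A) a → length (xs ∷ʳ a) ≡ suc (length xs)
length-∷ʳ xs a = trans (length-++ xs) (+-comm (length xs) 1)

majWord : List ℕ → ℕ
majWord = majAux 1

majAux-∷ʳ : ∀ t b r a →
  majAux t ((b ∷ r) ∷ʳ a) ≡ majAux t (b ∷ r) + (if a <ᵇ lastOr b r then t + length r else 0)
majAux-∷ʳ t b []      a =
  trans (+-identityʳ _) (cong (λ s → if a <ᵇ b then s else 0) (sym (+-identityʳ t)))
majAux-∷ʳ t b (c ∷ r) a = begin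
    descent + majAux (suc t) ((c ∷ r) ∷ʳ a)
  ≡⟨ cong (descent +_) (majAux-∷ʳ (suc t) c r a) ⟩
    descent + (majAux (suc t) (c ∷ r) + (if a <ᵇ lastOr c r then suc t + length r else 0))
  ≡⟨ sym (+-assoc descent _ _) ⟩
    descent + majAux (suc t) (c ∷ r) + (if a <ᵇ lastOr c r then suc t + length r else 0)
  ≡⟨ cong (λ s → majAux t (b ∷ c ∷ r) + (if a <ᵇ lastOr c r then s else 0)) (sym (+-suc t (length r))) ⟩
    majAux t (b ∷ c ∷ r) + (if a <ᵇ lastOr c r then t + suc (length r) else 0) ∎
  where
  open ≡-Reasoning
  descent = if c <ᵇ b then t else 0

majWord-∷ʳ : ∀ xs a → majWord (xs ∷ʳ a) ≡ majWord xs + (if a <ᵇ lastOr 0 xs then length xs else 0)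
majWord-∷ʳ []      a = refl
majWord-∷ʳ (b ∷ r) a = majAux-∷ʳ 1 b r a

majWord-∷ʳ-max : ∀ {M} xs → All (_< M) xs → majWord (xs ∷ʳ M) ≡ majWord xs
majWord-∷ʳ-max {M} xs xs<M = begin
    majWord (xs ∷ʳ M)
  ≡⟨ majWord-∷ʳ xs M ⟩
    majWord xs + (if M <ᵇ lastOr 0 xs then length xs else 0)
  ≡⟨ cong (λ b → majWord xs + (if b then length xs else 0)) (<ᵇ-false (lastOr-≤ 0 xs z≤n xs<M)) ⟩
    majWord xs + 0
  ≡⟨ +-identityʳ _ ⟩
    majWord xs ∎
  where open ≡-Reasoning

insertAtℕ : {A : Set} → ℕ → A → List A → List A
insertAtℕ zero    x ys       = x ∷ ys
insertAtℕ (suc p) x []       = x ∷ []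
insertAtℕ (suc p) x (y ∷ ys) = y ∷ insertAtℕ p x ys

module _ {A : Set} where

  insertAtℕ-∷ʳ : ∀ p (x : A) xs a → p ≤ length xs → insertAtℕ p x (xs ∷ʳ a) ≡ insertAtℕ p x xs ∷ʳ a
  insertAtℕ-∷ʳ zero    x xs       a _         = refl
  insertAtℕ-∷ʳ (suc p) x (y ∷ xs) a (s≤s p≤n) = cong (y ∷_) (insertAtℕ-∷ʳ p x xs a p≤n)

  insertAtℕ-length : ∀ (x : A) xs → insertAtℕ (length xs) x xs ≡ xs ∷ʳ x
  insertAtℕ-length x []       = refl
  insertAtℕ-length x (y ∷ xs) = cong (y ∷_) (insertAtℕ-length x xs)

  length-insertAtℕ : ∀ p (x : A) xs → p ≤ length xs → length (insertAtℕ p x xs) ≡ suc (length xs)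
  length-insertAtℕ zero    x xs       _         = refl
  length-insertAtℕ (suc p) x (y ∷ xs) (s≤s p≤n) = cong suc (length-insertAtℕ p x xs p≤n)

lastOr-insertAtℕ : ∀ d p x xs → p < length xs → lastOr d (insertAtℕ p x xs) ≡ lastOr d xs
lastOr-insertAtℕ d zero    x (y ∷ xs) _         = refl
lastOr-insertAtℕ d (suc p) x (y ∷ xs) (s≤s p<n) = lastOr-insertAtℕ y p x xs p<n

module _ (M : ℕ) {xs : List ℕ} (a : ℕ) where

  majWord-insertAtℕ-∷ʳ : ∀ p → p < length xs →
    majWord (insertAtℕ p M (xs ∷ʳ a))
      ≡ majWord (insertAtℕ p M xs) + (if a <ᵇ lastOr 0 xs then suc (length xs) else 0)
  majWord-insertAtℕ-∷ʳ p p<n = begin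
      majWord (insertAtℕ p M (xs ∷ʳ a))
    ≡⟨ cong majWord (insertAtℕ-∷ʳ p M xs a (<⇒≤ p<n)) ⟩
      majWord (ys ∷ʳ a)
    ≡⟨ majWord-∷ʳ ys a ⟩
      majWord ys + (if a <ᵇ lastOr 0 ys then length ys else 0)
    ≡⟨ cong₂ (λ l n → majWord ys + (if a <ᵇ l then n else 0))
             (lastOr-insertAtℕ 0 p M xs p<n) (length-insertAtℕ p M xs (<⇒≤ p<n)) ⟩
      majWord ys + (if a <ᵇ lastOr 0 xs then suc (length xs) else 0) ∎
    where
    open ≡-Reasoning
    ys = insertAtℕ p M xs

  majWord-insertAtℕ-before-last : All (_< M) xs → a < M →
    majWord (insertAtℕ (length xs) M (xs ∷ʳ a)) ≡ majWord xs + suc (length xs)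
  majWord-insertAtℕ-before-last xs<M a<M = begin
      majWord (insertAtℕ (length xs) M (xs ∷ʳ a))
    ≡⟨ cong majWord (trans (insertAtℕ-∷ʳ (length xs) M xs a ≤-refl)
                           (cong (_∷ʳ a) (insertAtℕ-length M xs))) ⟩
      majWord (xs ∷ʳ M ∷ʳ a)
    ≡⟨ majWord-∷ʳ (xs ∷ʳ M) a ⟩
      majWord (xs ∷ʳ M) + (if a <ᵇ lastOr 0 (xs ∷ʳ M) then length (xs ∷ʳ M) else 0)
    ≡⟨ cong₂ _+_ (majWord-∷ʳ-max xs xs<M)
             (cong₂ (λ b n → if b then n else 0) (trans (cong (a <ᵇ_) (lastOr-∷ʳ 0 xs M)) (<ᵇ-true a<M))
                    (length-∷ʳ xs M)) ⟩
      majWord xs + suc (length xs) ∎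
    where open ≡-Reasoning

  majWord-insertAtℕ-last : All (_< M) (xs ∷ʳ a) →
    majWord (insertAtℕ (suc (length xs)) M (xs ∷ʳ a)) ≡ majWord (xs ∷ʳ a)
  majWord-insertAtℕ-last xsa<M = begin
      majWord (insertAtℕ (suc (length xs)) M (xs ∷ʳ a))
    ≡⟨ cong (λ n → majWord (insertAtℕ n M (xs ∷ʳ a))) (sym (length-∷ʳ xs a)) ⟩
      majWord (insertAtℕ (length (xs ∷ʳ a)) M (xs ∷ʳ a))
    ≡⟨ cong majWord (insertAtℕ-length M (xs ∷ʳ a)) ⟩
      majWord (xs ∷ʳ a ∷ʳ M)
    ≡⟨ majWord-∷ʳ-max (xs ∷ʳ a) xsa<M ⟩
      majWord (xs ∷ʳ a) ∎
    where open ≡-Reasoning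

-- The multiset identity {m+1,…,m+L} + c ∪ {m+L+1} ∪ {m+d} = {m+d,…,m+d+L+1}
-- for (c , d) = (L+1 , L) or (0 , 0).
∑<-merge : ∀ (δ : Bool) L m (h : ℕ → ℕ) →
  ∑[ r < L ] h (m + suc r + (if δ then suc L else 0)) + h (m + suc L) + h (m + (if δ then L else 0))
    ≡ ∑[ r < suc (suc L) ] h (m + (if δ then L else 0) + r)
∑<-merge true L m h = begin
    ∑[ r < L ] h (m + suc r + suc L) + h (m + suc L) + h (m + L)
  ≡⟨ cong₂ (λ s t → s + t + h (m + L))
           (∑<-cong L (λ r _ → cong h (shift₂ m r L))) (cong h (shift₁ m L)) ⟩
    ∑[ r < L ] g (suc (suc r)) + g 1 + h (m + L)
  ≡⟨ cong₂ _+_ (∑<-rotate L (λ r → g (suc r))) (cong h (sym (+-identityʳ (m + L)))) ⟩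
    ∑[ r < suc L ] g (suc r) + g 0
  ≡⟨ ∑<-rotate (suc L) g ⟩
    ∑[ r < suc (suc L) ] g r ∎
  where
  open ≡-Reasoning
  g : ℕ → ℕ
  g r = h (m + L + r)
  shift₂ : ∀ m r L → m + suc r + suc L ≡ m + L + suc (suc r)
  shift₂ = solve-∀
  shift₁ : ∀ m L → m + suc L ≡ m + L + 1
  shift₁ = solve-∀
∑<-merge false L m h = begin
    ∑[ r < L ] h (m + suc r + 0) + h (m + suc L) + h (m + 0)
  ≡⟨ cong (λ s → s + h (m + suc L) + h (m + 0)) (∑<-cong L (λ r _ → cong h (+-identityʳ (m + suc r)))) ⟩
    ∑[ r < suc L ] h (m + suc r) + h (m + 0)
  ≡⟨ ∑<-rotate (suc L) (λ r → h (m + r)) ⟩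
    ∑[ r < suc (suc L) ] h (m + r)
  ≡⟨ ∑<-cong (suc (suc L)) (λ r _ → cong (λ n → h (n + r)) (sym (+-identityʳ m))) ⟩
    ∑[ r < suc (suc L) ] h (m + 0 + r) ∎
  where open ≡-Reasoning

-- Quantifying over h makes this an equality of multisets: MacMahon's insertion lemma.
∑-majWord-insertAtℕ : ∀ M xs → All (_< M) xs → ∀ (h : ℕ → ℕ) →
  ∑[ p < suc (length xs) ] h (majWord (insertAtℕ p M xs)) ≡ ∑[ r < suc (length xs) ] h (majWord xs + r)
∑-majWord-insertAtℕ M xs = go (reverseView xs)
  where
  go : ∀ {xs} → Reverse xs → All (_< M) xs → ∀ (h : ℕ → ℕ) →
       ∑[ p < suc (length xs) ] h (majWord (insertAtℕ p M xs)) ≡ ∑[ r < suc (length xs) ] h (majWord xs + r)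
  go []              _      h = refl
  go (xs ∶ rs ∶ʳ a) xsa<M h rewrite length-∷ʳ xs a = begin
      ∑[ p < L ] h (majWord (insertAtℕ p M (xs ∷ʳ a)))
        + h (majWord (insertAtℕ L M (xs ∷ʳ a))) + h (majWord (insertAtℕ (suc L) M (xs ∷ʳ a)))
    ≡⟨ cong₂ (λ s t → s + t + h (majWord (insertAtℕ (suc L) M (xs ∷ʳ a))))
             (∑<-cong L (λ p p<L → cong h (majWord-insertAtℕ-∷ʳ M a p p<L)))
             (cong h (majWord-insertAtℕ-before-last M a xs<M a<M)) ⟩
      ∑[ p < L ] h (majWord (insertAtℕ p M xs) + c) + h (m + suc L)
        + h (majWord (insertAtℕ (suc L) M (xs ∷ʳ a)))
    ≡⟨ cong₂ (λ s t → s + h (m + suc L) + h t) inner-positions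
             (trans (majWord-insertAtℕ-last M a xsa<M) (majWord-∷ʳ xs a)) ⟩
      ∑[ r < L ] h (m + suc r + c) + h (m + suc L) + h (m + d)
    ≡⟨ ∑<-merge δ L m h ⟩
      ∑[ r < suc (suc L) ] h (m + d + r)
    ≡⟨ ∑<-cong (suc (suc L)) (λ r _ → cong (λ n → h (n + r)) (sym (majWord-∷ʳ xs a))) ⟩
      ∑[ r < suc (suc L) ] h (majWord (xs ∷ʳ a) + r) ∎
    where
    open ≡-Reasoning
    L = length xs
    m = majWord xs
    δ = a <ᵇ lastOr 0 xs
    c = if δ then suc L else 0
    d = if δ then L else 0
    xs<M = proj₁ (∷ʳ⁻ xsa<M)
    a<M = proj₂ (∷ʳ⁻ xsa<M)
    maj-xs∷ʳM : majWord (insertAtℕ L M xs) ≡ m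
    maj-xs∷ʳM = trans (cong majWord (insertAtℕ-length M xs)) (majWord-∷ʳ-max xs xs<M)
    inner-positions : ∑[ p < L ] h (majWord (insertAtℕ p M xs) + c) ≡ ∑[ r < L ] h (m + suc r + c)
    inner-positions = +-cancelʳ-≡ (h (m + c)) _ _ (begin
        ∑[ p < L ] h (majWord (insertAtℕ p M xs) + c) + h (m + c)
      ≡⟨ cong (λ n → ∑[ p < L ] h (majWord (insertAtℕ p M xs) + c) + h (n + c)) (sym maj-xs∷ʳM) ⟩
        ∑[ p < suc L ] h (majWord (insertAtℕ p M xs) + c)
      ≡⟨ go rs xs<M (λ n → h (n + c)) ⟩
        ∑[ r < suc L ] h (m + r + c)
      ≡⟨ trans (∑<-suc L (λ r → h (m + r + c))) (+-comm (h (m + 0 + c)) _) ⟩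
        ∑[ r < L ] h (m + suc r + c) + h (m + 0 + c)
      ≡⟨ cong (λ n → ∑[ r < L ] h (m + suc r + c) + h (n + c)) (+-identityʳ m) ⟩
        ∑[ r < L ] h (m + suc r + c) + h (m + c) ∎)

word : ∀ {K m} → Vec (Fin K) m → List ℕ
word v = List.map toℕ (toList v)

length-word : ∀ {K m} (v : Vec (Fin K) m) → length (word v) ≡ m
length-word []      = refl
length-word (x ∷ v) = cong suc (length-word v)

word-bounded : ∀ {K m} (v : Vec (Fin K) m) → All (_< K) (word v)
word-bounded []      = []
word-bounded (x ∷ v) = toℕ<n x ∷ word-bounded v

word-insertAt : ∀ {K m} (v : Vec (Fin K) m) p x →
                word (insertAt v p x) ≡ insertAtℕ (toℕ p) (toℕ x) (word v)
word-insertAt v       zero    x = refl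
word-insertAt (y ∷ v) (suc p) x = cong (toℕ y ∷_) (word-insertAt v p x)

word-map : ∀ {K K′ m} (f : Fin K → Fin K′) (v : Vec (Fin K) m) →
           word (map f v) ≡ List.map (toℕ ∘′ f) (toList v)
word-map f v = trans (cong (List.map toℕ) (toList-map f v)) (sym (map-∘ (toList v)))

toℕ-punchIn-fromℕ : ∀ {N} (y : Fin N) → toℕ (punchIn (fromℕ N) y) ≡ toℕ y
toℕ-punchIn-fromℕ zero    = refl
toℕ-punchIn-fromℕ (suc y) = cong suc (toℕ-punchIn-fromℕ y)

punchIn-<ᵇ : ∀ {N} (p : Fin (suc N)) (a b : Fin N) →
             (toℕ (punchIn p a) <ᵇ toℕ (punchIn p b)) ≡ (toℕ a <ᵇ toℕ b)
punchIn-<ᵇ zero    a       b       = refl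
punchIn-<ᵇ (suc p) zero    zero    = refl
punchIn-<ᵇ (suc p) zero    (suc b) = refl
punchIn-<ᵇ (suc p) (suc a) zero    = refl
punchIn-<ᵇ (suc p) (suc a) (suc b) = punchIn-<ᵇ p a b

majAux-map-cong : ∀ t (f g : A → ℕ) → (∀ a b → (f a <ᵇ f b) ≡ (g a <ᵇ g b)) →
                  ∀ xs → majAux t (List.map f xs) ≡ majAux t (List.map g xs)
majAux-map-cong t f g f≈g []           = refl
majAux-map-cong t f g f≈g (x ∷ [])     = refl
majAux-map-cong t f g f≈g (x ∷ y ∷ xs) =
  cong₂ _+_ (cong (λ b → if b then t else 0) (f≈g y x)) (majAux-map-cong (suc t) f g f≈g (y ∷ xs))

module _ {N : ℕ} where

  maj-insertMax : ∀ (σ : Vec (Fin N) N) p → maj (insertMax σ p) ≡ majWord (insertAtℕ (toℕ p) N (word σ))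
  maj-insertMax σ p = cong majWord (trans (word-insertAt _ p (fromℕ N))
    (cong₂ (insertAtℕ (toℕ p)) (toℕ-fromℕ N)
           (trans (word-map _ σ) (map-cong toℕ-punchIn-fromℕ (toList σ)))))

  maj-map-punchIn : ∀ (τ : Vec (Fin N) N) p → majWord (word (map (punchIn p) τ)) ≡ maj τ
  maj-map-punchIn τ p =
    trans (cong majWord (word-map (punchIn p) τ)) (majAux-map-cong 1 _ toℕ (punchIn-<ᵇ p) (toList τ))

  maj-appendValue : ∀ (τ : Vec (Fin N) N) p →
    maj (appendValue τ p) ≡ maj τ + (if toℕ p <ᵇ lastOr 0 (word (map (punchIn p) τ)) then N else 0)
  maj-appendValue τ p = begin
      majWord (word (insertAt (map (punchIn p) τ) (fromℕ N) p))
    ≡⟨ cong majWord (word-insertAt _ (fromℕ N) p) ⟩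
      majWord (insertAtℕ (toℕ (fromℕ N)) (toℕ p) ys)
    ≡⟨ cong (λ n → majWord (insertAtℕ n (toℕ p) ys)) (trans (toℕ-fromℕ N) (sym |ys|≡N)) ⟩
      majWord (insertAtℕ (length ys) (toℕ p) ys)
    ≡⟨ cong majWord (insertAtℕ-length (toℕ p) ys) ⟩
      majWord (ys ∷ʳ toℕ p)
    ≡⟨ majWord-∷ʳ ys (toℕ p) ⟩
      majWord ys + (if toℕ p <ᵇ lastOr 0 ys then length ys else 0)
    ≡⟨ cong₂ (λ m n → m + (if toℕ p <ᵇ lastOr 0 ys then n else 0)) (maj-map-punchIn τ p) |ys|≡N ⟩
      maj τ + (if toℕ p <ᵇ lastOr 0 ys then N else 0) ∎
    where
    open ≡-Reasoning
    ys = word (map (punchIn p) τ)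
    |ys|≡N = length-word (map (punchIn p) τ)

  maj-appendValue-mod : ∀ (g : ℕ → ℕ) → (∀ a → g (a + N) ≡ g a) →
                        ∀ τ p → g (maj (appendValue τ p)) ≡ g (maj τ)
  maj-appendValue-mod g g-periodic τ p = trans (cong g (maj-appendValue τ p)) (drop-period _)
    where
    drop-period : ∀ b → g (maj τ + (if b then N else 0)) ≡ g (maj τ)
    drop-period true  = g-periodic (maj τ)
    drop-period false = cong g (+-identityʳ (maj τ))

  ∑-maj-insertMax : ∀ (σ : Vec (Fin N) N) (h : ℕ → ℕ) →
    ∑[ p ∈ allFin (suc N) ] h (maj (insertMax σ p)) ≡ ∑[ r < suc N ] h (maj σ + r)
  ∑-maj-insertMax σ h = begin
      ∑[ p ∈ allFin (suc N) ] h (maj (insertMax σ p))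
    ≡⟨ ∑-cong (allFin (suc N)) (λ p → cong h (maj-insertMax σ p)) ⟩
      ∑[ p ∈ allFin (suc N) ] h (majWord (insertAtℕ (toℕ p) N (word σ)))
    ≡⟨ ∑-allFin-toℕ (suc N) (λ q → h (majWord (insertAtℕ q N (word σ)))) ⟩
      ∑[ q < suc N ] h (majWord (insertAtℕ q N (word σ)))
    ≡⟨ subst (λ L → ∑[ q < suc L ] h (majWord (insertAtℕ q N (word σ))) ≡ ∑[ r < suc L ] h (maj σ + r))
             (length-word σ) (∑-majWord-insertAtℕ N (word σ) (word-bounded σ) h) ⟩
      ∑[ r < suc N ] h (maj σ + r) ∎
    where open ≡-Reasoning

-- Residue classes

inClass : ℤ → ℕ → ℕ → ℕ
inClass i k a = 𝟙 (a ≡? i [mod k ])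

module _ {k : ℕ} (i : ℤ) where

  open Int using (+_; -_; _-_)

  private
    shifted : ∀ a d → + (a + d) - i ≡ (+ a - i) Int.+ + d
    shifted a d = trans (cong (_- i) (pos-+ a d)) (rearrange (+ a) (+ d) i)
      where
      rearrange : ∀ (a d i : ℤ) → a Int.+ d - i ≡ (a - i) Int.+ d
      rearrange = ℤ-Solver.solve-∀

    toSigned : ∀ {a} → a ≡ i [mod k ] → + k ∣ℤ + a - i
    toSigned {a} = ∣ᵤ⇒∣ {+ k} {+ a - i}

    fromSigned : ∀ {a} → + k ∣ℤ + a - i → a ≡ i [mod k ]
    fromSigned {a} = ∣⇒∣ᵤ {+ k} {+ a - i}

    ℕ⇒signed : ∀ {d} → k ∣ d → + k ∣ℤ + d
    ℕ⇒signed {d} = ∣ᵤ⇒∣ {+ k} {+ d}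

    signed⇒ℕ : ∀ {d} → + k ∣ℤ + d → k ∣ d
    signed⇒ℕ {d} = ∣⇒∣ᵤ {+ k} {+ d}

  ≡[mod]-+-multiple : ∀ {d} a → k ∣ d → ((a + d) ≡ i [mod k ]) ⇔ (a ≡ i [mod k ])
  ≡[mod]-+-multiple {d} a k∣d = mk⇔
    (λ a+d≡i → fromSigned (∣m+n∣n⇒∣m (subst (+ k ∣ℤ_) (shifted a d) (toSigned a+d≡i)) (ℕ⇒signed k∣d)))
    (λ a≡i → fromSigned (subst (+ k ∣ℤ_) (sym (shifted a d)) (∣m∣n⇒∣m+n (toSigned a≡i) (ℕ⇒signed k∣d))))

  ≡[mod]-+-unique : ∀ {a} d → a ≡ i [mod k ] → (a + d) ≡ i [mod k ] → k ∣ d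
  ≡[mod]-+-unique {a} d a≡i a+d≡i =
    signed⇒ℕ (∣m+n∣m⇒∣n (subst (+ k ∣ℤ_) (shifted a d) (toSigned a+d≡i)) (toSigned a≡i))

  %ℕ-≡[mod] : .{{_ : NonZero k}} → (i %ℕ k) ≡ i [mod k ]
  %ℕ-≡[mod] = fromSigned (subst (+ k ∣ℤ_) (sym x₀-i) (∣m⇒∣-m (∣n⇒∣m*n (i /ℕ k) ∣ℤ-refl)))
    where
    cancel : ∀ (x q : ℤ) → x - (x Int.+ q) ≡ - q
    cancel = ℤ-Solver.solve-∀
    x₀-i : + (i %ℕ k) - i ≡ - ((i /ℕ k) Int.* + k)
    x₀-i = trans (cong (λ z → + (i %ℕ k) - z) (a≡a%ℕn+[a/ℕn]*n i k)) (cancel (+ (i %ℕ k)) _)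

inClass-periodic : ∀ i k {d} → k ∣ d → ∀ a → inClass i k (a + d) ≡ inClass i k a
inClass-periodic i k {d} k∣d a =
  𝟙-⇔ (≡[mod]-+-multiple i a k∣d) ((a + d) ≡? i [mod k ]) (a ≡? i [mod k ])

module _ (f : ℕ → ℕ) where

  ∑<-periodic-shift : ∀ k → (∀ a → f (a + k) ≡ f a) →
                      ∀ y → ∑[ r < k ] f (suc y + r) ≡ ∑[ r < k ] f (y + r)
  ∑<-periodic-shift zero     f-periodic y = refl
  ∑<-periodic-shift (suc k′) f-periodic y = begin
      ∑[ r < k′ ] f (suc y + r) + f (suc y + k′)
    ≡⟨ cong₂ _+_ (∑<-cong k′ (λ r _ → cong f (sym (+-suc y r)))) (cong f (sym (+-suc y k′))) ⟩
      ∑[ r < k′ ] f (y + suc r) + f (y + suc k′)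
    ≡⟨ cong (λ t → ∑[ r < k′ ] f (y + suc r) + t) (trans (f-periodic y) (cong f (sym (+-identityʳ y)))) ⟩
      ∑[ r < k′ ] f (y + suc r) + f (y + 0)
    ≡⟨ ∑<-rotate k′ (λ r → f (y + r)) ⟩
      ∑[ r < suc k′ ] f (y + r) ∎
    where open ≡-Reasoning

  module _ (k : ℕ) (f-periodic : ∀ a → f (a + k) ≡ f a) where

    ∑<-periodic-window : ∀ y → ∑[ r < k ] f (y + r) ≡ ∑[ r < k ] f r
    ∑<-periodic-window zero    = refl
    ∑<-periodic-window (suc y) = trans (∑<-periodic-shift k f-periodic y) (∑<-periodic-window y)

    ∑<-periodic-blocks : ∀ q y → ∑[ r < q * k ] f (y + r) ≡ q * ∑[ r < k ] f r
    ∑<-periodic-blocks zero    y = refl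
    ∑<-periodic-blocks (suc q) y = begin
        ∑[ r < k + q * k ] f (y + r)
      ≡⟨ ∑<-+ k (q * k) (λ r → f (y + r)) ⟩
        ∑[ r < k ] f (y + r) + ∑[ r < q * k ] f (y + (k + r))
      ≡⟨ cong₂ _+_ (∑<-periodic-window y) (∑<-cong (q * k) (λ r _ → cong f (sym (+-assoc y k r)))) ⟩
        ∑[ r < k ] f r + ∑[ r < q * k ] f (y + k + r)
      ≡⟨ cong (λ t → ∑[ r < k ] f r + t) (∑<-periodic-blocks q (y + k)) ⟩
        ∑[ r < k ] f r + q * ∑[ r < k ] f r ∎
      where open ≡-Reasoning

-- All windows of length k have the same sum, and the window starting at x₀ = i %ℕ k has its only
-- hit at x₀, since two hits differ by a multiple of k.
∑<-inClass-period : ∀ i k .{{_ : NonZero k}} → ∑[ r < k ] inClass i k r ≡ 1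
∑<-inClass-period i (suc k′) = begin
    ∑[ r < k ] f r
  ≡⟨ sym (∑<-periodic-window f k (inClass-periodic i k ∣-refl) x₀) ⟩
    ∑[ r < k ] f (x₀ + r)
  ≡⟨ ∑<-suc k′ (λ r → f (x₀ + r)) ⟩
    f (x₀ + 0) + ∑[ r < k′ ] f (x₀ + suc r)
  ≡⟨ cong₂ _+_ (𝟙-yes (_ ≡? i [mod k ]) (subst (_≡ i [mod k ]) (sym (+-identityʳ x₀)) x₀≡i))
               (∑<-zero k′ (λ r r<k′ → 𝟙-no (_ ≡? i [mod k ]) (λ x₀+1+r≡i →
                  <⇒≱ r<k′ (s≤s⁻¹ (∣⇒≤ (≡[mod]-+-unique i (suc r) x₀≡i x₀+1+r≡i)))))) ⟩
    1 ∎
  where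
  open ≡-Reasoning
  k = suc k′
  f = inClass i k
  x₀ = i %ℕ k
  x₀≡i = %ℕ-≡[mod] i

∑<-inClass : ∀ i k .{{_ : NonZero k}} {n} → k ∣ n → ∀ y → ∑[ r < n ] inClass i k (y + r) ≡ n / k
∑<-inClass i k (divides q refl) y = begin
    ∑[ r < q * k ] inClass i k (y + r)
  ≡⟨ ∑<-periodic-blocks (inClass i k) k (inClass-periodic i k ∣-refl) q y ⟩
    q * ∑[ r < k ] inClass i k r
  ≡⟨ cong (q *_) (∑<-inClass-period i k) ⟩
    q * 1
  ≡⟨ *-identityʳ q ⟩
    q
  ≡⟨ sym (m*n/n≡m q k) ⟩
    q * k / k ∎
  where open ≡-Reasoning

-- The recurrence

module _ (N : ℕ) where

  private
    Perm = Vec (Fin N) N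

  ∑Perm-cong : {F G : Perm → Perm → ℕ} → (∀ σ τ → F σ τ ≡ G σ τ) → ∑Perm N F ≡ ∑Perm N G
  ∑Perm-cong F≗G =
    ∑-cong (allVec N N) (λ σ → ∑-cong (allVec N N) (λ τ → cong (𝟙 (isInverse? σ τ) *_) (F≗G σ τ)))

  ∑Perm-+ : ∀ (F G : Perm → Perm → ℕ) → ∑Perm N (λ σ τ → F σ τ + G σ τ) ≡ ∑Perm N F + ∑Perm N G
  ∑Perm-+ F G = trans
    (∑-cong (allVec N N) (λ σ → trans
      (∑-cong (allVec N N) (λ τ → *-distribˡ-+ (𝟙 (isInverse? σ τ)) (F σ τ) (G σ τ)))
      (∑-+ (allVec N N) _ _)))
    (∑-+ (allVec N N) _ _)

  ∑Perm-*ˡ : ∀ c (F : Perm → Perm → ℕ) → ∑Perm N (λ σ τ → c * F σ τ) ≡ c * ∑Perm N F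
  ∑Perm-*ˡ c F = trans
    (∑-cong (allVec N N) (λ σ → trans
      (∑-cong (allVec N N) (λ τ → *-leftComm (𝟙 (isInverse? σ τ)) c (F σ τ)))
      (∑-*ˡ (allVec N N) c _)))
    (∑-*ˡ (allVec N N) c _)

  ∑Perm-flip : ∀ (F : Perm → Perm → ℕ) → ∑Perm N F ≡ ∑Perm N (λ σ τ → F τ σ)
  ∑Perm-flip F = trans (∑-comm (allVec N N) (allVec N N) _)
    (∑-cong (allVec N N) (λ τ → ∑-cong (allVec N N) (λ σ →
      cong (_* F σ τ) (𝟙-⇔ (mk⇔ Product.swap Product.swap) (isInverse? σ τ) (isInverse? τ σ)))))

mCount≡∑Perm : ∀ N i k j ℓ →
  mCount N i k j ℓ ≡ ∑Perm N (λ σ τ → inClass i k (maj σ) * inClass j ℓ (maj τ))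
mCount≡∑Perm N i k j ℓ = begin
    length (filter classes? (permPairs N))
  ≡⟨ length-filter classes? (permPairs N) ⟩
    ∑[ π ∈ permPairs N ] 𝟙 (classes? π)
  ≡⟨ ∑-filter inverse? pairs _ ⟩
    ∑[ π ∈ pairs ] (𝟙 (inverse? π) * 𝟙 (classes? π))
  ≡⟨ ∑-concatMap (λ σ → List.map (σ ,_) (allVec N N)) (allVec N N) _ ⟩
    ∑[ σ ∈ allVec N N ] ∑[ π ∈ List.map (σ ,_) (allVec N N) ] (𝟙 (inverse? π) * 𝟙 (classes? π))
  ≡⟨ ∑-cong (allVec N N) (λ σ → trans (∑-map (σ ,_) (allVec N N) _)
       (∑-cong (allVec N N) (λ τ → cong (𝟙 (isInverse? σ τ) *_)
         (𝟙-×-dec (maj σ ≡? i [mod k ]) (maj τ ≡? j [mod ℓ ]))))) ⟩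
    ∑Perm N (λ σ τ → inClass i k (maj σ) * inClass j ℓ (maj τ)) ∎
  where
  open ≡-Reasoning
  classes? = λ (π : Vec (Fin N) N × Vec (Fin N) N) →
    (maj (proj₁ π) ≡? i [mod k ]) ×-dec (maj (proj₂ π) ≡? j [mod ℓ ])
  inverse? = λ (π : Vec (Fin N) N × Vec (Fin N) N) → isInverse? (proj₁ π) (proj₂ π)
  pairs = concatMap (λ σ → List.map (σ ,_) (allVec N N)) (allVec N N)

∑Perm-maj-suc : ∀ N (f g : ℕ → ℕ) → (∀ a → g (a + N) ≡ g a) →
  ∑Perm (suc N) (λ σ τ → f (maj σ) * g (maj τ))
    ≡ ∑Perm N (λ σ τ → ∑[ r < suc N ] f (maj σ + r) * g (maj τ))
∑Perm-maj-suc N f g g-periodic = trans (∑Perm-suc N _) (∑Perm-cong N λ σ τ → begin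
    ∑[ p ∈ allFin (suc N) ] (f (maj (insertMax σ p)) * g (maj (appendValue τ p)))
  ≡⟨ ∑-cong (allFin (suc N)) (λ p →
       cong (f (maj (insertMax σ p)) *_) (maj-appendValue-mod g g-periodic τ p)) ⟩
    ∑[ p ∈ allFin (suc N) ] (f (maj (insertMax σ p)) * g (maj τ))
  ≡⟨ ∑-*ʳ (allFin (suc N)) (g (maj τ)) (λ p → f (maj (insertMax σ p))) ⟩
    ∑[ p ∈ allFin (suc N) ] f (maj (insertMax σ p)) * g (maj τ)
  ≡⟨ cong (_* g (maj τ)) (∑-maj-insertMax σ f) ⟩
    ∑[ r < suc N ] f (maj σ + r) * g (maj τ) ∎)
  where open ≡-Reasoning

∑Perm-count : ∀ N → ∑Perm N (λ _ _ → 1) ≡ N !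
∑Perm-count zero    = refl
∑Perm-count (suc N) = begin
    ∑Perm (suc N) (λ _ _ → 1)
  ≡⟨ ∑Perm-maj-suc N (λ _ → 1) (λ _ → 1) (λ _ → refl) ⟩
    ∑Perm N (λ _ _ → ∑[ r < suc N ] 1 * 1)
  ≡⟨ ∑Perm-cong N (λ _ _ → cong (_* 1) (∑<-const (suc N) 1)) ⟩
    ∑Perm N (λ _ _ → suc N * 1 * 1)
  ≡⟨ ∑Perm-*ˡ N (suc N * 1) (λ _ _ → 1) ⟩
    suc N * 1 * ∑Perm N (λ _ _ → 1)
  ≡⟨ cong₂ _*_ (*-identityʳ (suc N)) (∑Perm-count N) ⟩
    suc N * N ! ∎
  where open ≡-Reasoning

∑Perm-maj-equidistributed : ∀ M (f : ℕ → ℕ) c → (∀ a → ∑[ r < suc M ] f (a + r) ≡ c) →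
                            ∑Perm (suc M) (λ σ _ → f (maj σ)) ≡ c * M !
∑Perm-maj-equidistributed M f c f-windows = begin
    ∑Perm (suc M) (λ σ _ → f (maj σ))
  ≡⟨ ∑Perm-cong (suc M) (λ σ _ → sym (*-identityʳ (f (maj σ)))) ⟩
    ∑Perm (suc M) (λ σ τ → f (maj σ) * 1)
  ≡⟨ ∑Perm-maj-suc M f (λ _ → 1) (λ _ → refl) ⟩
    ∑Perm M (λ σ _ → ∑[ r < suc M ] f (maj σ + r) * 1)
  ≡⟨ ∑Perm-cong M (λ σ _ → cong (_* 1) (f-windows (maj σ))) ⟩
    ∑Perm M (λ _ _ → c * 1)
  ≡⟨ ∑Perm-*ˡ M c (λ _ _ → 1) ⟩
    c * ∑Perm M (λ _ _ → 1)
  ≡⟨ cong (c *_) (∑Perm-count M) ⟩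
    c * M ! ∎
  where open ≡-Reasoning

/-square : ∀ {N} k ℓ .{{_ : NonZero k}} .{{_ : NonZero ℓ}} → k ∣ N → ℓ ∣ N → ∀ c →
           N / k * (N / ℓ * c) ≡ _/_ (c * N ^ 2) (k * ℓ) {{m*n≢0 k ℓ}}
/-square {N} (suc k′) (suc ℓ′) k∣N ℓ∣N c = sym (begin
    c * N ^ 2 / (k * ℓ)
  ≡⟨ cong (λ t → c * t / (k * ℓ)) (cong (N *_) (*-identityʳ N)) ⟩
    c * (N * N) / (k * ℓ)
  ≡⟨ *-/-assoc c (*-pres-∣ k∣N ℓ∣N) ⟩
    c * (N * N / (k * ℓ))
  ≡⟨ cong (c *_) (/-*-interchange k∣N ℓ∣N) ⟩
    c * (N / k * (N / ℓ))
  ≡⟨ *-rotate c (N / k) (N / ℓ) ⟩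
    N / k * (N / ℓ * c) ∎)
  where
  open ≡-Reasoning
  k = suc k′
  ℓ = suc ℓ′

proposition3p2 : (n k ℓ : ℕ) .{{_ : NonZero k}} .{{_ : NonZero ℓ}} →
    3 ≤ n → k ∣ n ∸ 1 → ℓ ∣ n ∸ 1 → k ≢ 1 → ℓ ≢ 1 → (i j : ℤ) →
    mCount n i k j ℓ ≡ _/_ ((n ∸ 2) ! * (n ∸ 1) ^ 2) (k * ℓ) {{m*n≢0 k ℓ}} + mCount (n ∸ 1) i k j ℓ
proposition3p2 (suc (suc (suc m))) k ℓ (s≤s (s≤s (s≤s _))) k∣N ℓ∣N _ _ i j = begin
    mCount (suc N) i k j ℓ
  ≡⟨ mCount≡∑Perm (suc N) i k j ℓ ⟩
    ∑Perm (suc N) (λ σ τ → χᵢ (maj σ) * χⱼ (maj τ))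
  ≡⟨ ∑Perm-maj-suc N χᵢ χⱼ (inClass-periodic j ℓ ℓ∣N) ⟩
    ∑Perm N (λ σ τ → ∑[ r < suc N ] χᵢ (maj σ + r) * χⱼ (maj τ))
  ≡⟨ ∑Perm-cong N (λ σ τ → trans (cong (_* χⱼ (maj τ)) (χᵢ-window (maj σ)))
                                   (*-distribʳ-+ (χⱼ (maj τ)) (χᵢ (maj σ)) (N / k))) ⟩
    ∑Perm N (λ σ τ → χᵢ (maj σ) * χⱼ (maj τ) + N / k * χⱼ (maj τ))
  ≡⟨ ∑Perm-+ N _ _ ⟩
    ∑Perm N (λ σ τ → χᵢ (maj σ) * χⱼ (maj τ)) + ∑Perm N (λ σ τ → N / k * χⱼ (maj τ))
  ≡⟨ cong₂ _+_ (sym (mCount≡∑Perm N i k j ℓ)) (∑Perm-*ˡ N (N / k) _) ⟩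
    mCount N i k j ℓ + N / k * ∑Perm N (λ σ τ → χⱼ (maj τ))
  ≡⟨ cong (λ t → mCount N i k j ℓ + N / k * t)
          (trans (∑Perm-flip N _) (∑Perm-maj-equidistributed M χⱼ (N / ℓ) (∑<-inClass j ℓ ℓ∣N))) ⟩
    mCount N i k j ℓ + N / k * (N / ℓ * M !)
  ≡⟨ trans (+-comm (mCount N i k j ℓ) _) (cong (_+ mCount N i k j ℓ) (/-square k ℓ k∣N ℓ∣N (M !))) ⟩
    _/_ (M ! * N ^ 2) (k * ℓ) {{m*n≢0 k ℓ}} + mCount N i k j ℓ ∎
  where
  open ≡-Reasoning
  M = suc m
  N = suc M
  χᵢ = inClass i k
  χⱼ = inClass j ℓ
  χᵢ-window : ∀ a → ∑[ r < suc N ] χᵢ (a + r) ≡ χᵢ a + N / k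
  χᵢ-window a = trans (∑<-suc N (λ r → χᵢ (a + r)))
    (cong₂ _+_ (cong χᵢ (+-identityʳ a))
               (trans (∑<-cong N (λ r _ → cong χᵢ (+-suc a r))) (∑<-inClass i k k∣N (suc a))))
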